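{- Let $(G,\sigma)$ and $(H,\pi)$ be signed graphs and let $f\colon V(G)\to V(H)$ be a mapping. Then $f$ is a homomorphism of $(G,\sigma)$ to $(H,\pi)$ if and only if all of the following hold: (i) $f$ is a homomorphism of the underlying graph $G$ to the underlying graph $H$ (adjacent vertices, including a vertex with a loop and itself, are mapped to adjacent vertices); (ii) $f$ maps bicoloured edges (and loops) of $(G,\sigma)$ to bicoloured edges (loops) of $(H,\pi)$; (iii) for every closed walk $W$ in $(G,\sigma)$ consisting only of unicoloured edges, such that the image walk $f(W)$ also consists only of unicoloured edges of $(H,\pi)$, the sign of $W$ equals the sign of $f(W)$.
   Context: A signed graph $(G,\sigma)$ is a graph $G$ with possible loops and with at most two edges between any two vertices and at most two loops at any vertex, together with a map $\sigma$ assigning a sign $+$ (blue) or $-$ (red) to every edge and loop, such that two edges with the same endpoints (or two loops at the same vertex) have different signs. A red–blue pair of edges (loops) with the same endpoint(s) is called a bicoloured edge (loop); all other edges and loops are unicoloured. Walks are sequences of consecutively adjacent vertices; for a closed walk consisting of unicoloured edges its sign is the product of the signs of its edges. Switching at a vertex $v$ negates the sign of every non-loop edge incident with $v$ (loops are unchanged); two signatures are switching equivalent if one is obtained from the other by a sequence of switchings. A homomorphism $f\colon (G,\sigma)\to(H,\pi)$ is a map $f\colon V(G)\to V(H)$ for which there is a signature $\sigma'$ switching equivalent to $\sigma$ such that whenever $uv$ (an edge or loop) is at least positive (i.e. positive, possibly as part of a bicoloured pair) in $(G,\sigma')$, then $f(u)f(v)$ is an at least positive edge or loop in $(H,\pi)$,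 and whenever $uv$ is at least negative in $(G,\sigma')$, then $f(u)f(v)$ is an at least negative edge or loop in $(H,\pi)$. -}

module Defs where

open import Data.Nat using (ℕ)
open import Data.Fin using (Fin; _≟_)
open import Data.Bool using (Bool; true; false; _∧_; _∨_; not; if_then_else_)
open import Data.List using (List; []; _∷_; map)
open import Data.List.Relation.Unary.All using (All)
open import Data.Product using (Σ; _×_; _,_; ∃)
open import Relation.Nullary.Decidable using (⌊_⌋)
open import Relation.Binary.PropositionalEquality using (_≡_)
open import Relation.Binary.Construct.Closure.ReflexiveTransitive using (Star)

-- A signed graph on the finite vertex set Fin n.
-- pos u v = true  : there is a positive (blue) edge / loop (u = v) between u and v
-- neg u v = true  : there is a negative (red) edge / loop between u and v
-- This encodes exactly: at most two edges between two vertices, at most two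
-- loops at a vertex, and parallel edges (loops) having different signs.
-- Both pos and neg true = bicoloured edge (loop).
record Signed (n : ℕ) : Set where
  field
    pos : Fin n → Fin n → Bool
    neg : Fin n → Fin n → Bool
    pos-sym : ∀ u v → pos u v ≡ pos v u
    neg-sym : ∀ u v → neg u v ≡ neg v u
open Signed public

Adj : ∀ {n} → Signed n → Fin n → Fin n → Set
Adj G u v = (pos G u v ∨ neg G u v) ≡ true

Bicol : ∀ {n} → Signed n → Fin n → Fin n → Set
Bicol G u v = (pos G u v ∧ neg G u v) ≡ true

Unicol : ∀ {n} → Signed n → Fin n → Fin n → Set
Unicol G u v = (pos G u v ∧ not (neg G u v)) ∨ (neg G u v ∧ not (pos G u v)) ≡ true

flips : ∀ {n} → Fin n → Fin n → Fin n → Bool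
flips v u w = not ⌊ u ≟ w ⌋ ∧ (⌊ u ≟ v ⌋ ∨ ⌊ w ≟ v ⌋)

SwitchAt : ∀ {n} → Signed n → Signed n → Set
SwitchAt G H = ∃ λ v → ∀ u w →
  (pos H u w ≡ (if flips v u w then neg G u w else pos G u w)) ×
  (neg H u w ≡ (if flips v u w then pos G u w else neg G u w))

SwEq : ∀ {n} → Signed n → Signed n → Set
SwEq = Star SwitchAt

IsHom : ∀ {n m} → Signed n → Signed m → (Fin n → Fin m) → Set
IsHom G H f = Σ _ λ G' → SwEq G G' ×
  (∀ u v → pos G' u v ≡ true → pos H (f u) (f v) ≡ true) ×
  (∀ u v → neg G' u v ≡ true → neg H (f u) (f v) ≡ true)

data Sign : Set where
  plus minus : Sign

_·_ : Sign → Sign → Sign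
plus · s = s
minus · plus = minus
minus · minus = plus

edgeSign : ∀ {n} → Signed n → Fin n → Fin n → Sign
edgeSign G u v = if pos G u v then plus else minus

-- A walk is given by a start vertex x and the list of subsequent vertices.
steps : ∀ {n} → Fin n → List (Fin n) → List (Fin n × Fin n)
steps x [] = []
steps x (y ∷ ys) = (x , y) ∷ steps y ys

endpoint : ∀ {n} → Fin n → List (Fin n) → Fin n
endpoint x [] = x
endpoint x (y ∷ ys) = endpoint y ys

UniWalk : ∀ {n} → Signed n → Fin n → List (Fin n) → Set
UniWalk G x vs = All (λ e → Unicol G (Data.Product.proj₁ e) (Data.Product.proj₂ e)) (steps x vs)

walkSign : ∀ {n} → Signed n → Fin n → List (Fin n) → Sign
walkSign G x [] = plus
walkSign G x (y ∷ ys) = edgeSign G x y · walkSign G y ys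

CondI : ∀ {n m} → Signed n → Signed m → (Fin n → Fin m) → Set
CondI G H f = ∀ u v → Adj G u v → Adj H (f u) (f v)

CondII : ∀ {n m} → Signed n → Signed m → (Fin n → Fin m) → Set
CondII G H f = ∀ u v → Bicol G u v → Bicol H (f u) (f v)

CondIII : ∀ {n m} → Signed n → Signed m → (Fin n → Fin m) → Set
CondIII G H f = ∀ x vs → endpoint x vs ≡ x → UniWalk G x vs →
  UniWalk H (f x) (map f vs) → walkSign G x vs ≡ walkSign H (f x) (map f vs)

module Submission where

-- Signs are encoded as elements of ℤ/2 = (Bool, xor) and labellings of
-- vertex pairs are summed along walks.  Switching at the vertex set of
-- s : Fin n → Bool flips exactly the pairs in the cut of s (s u xor s w);
-- every switching sequence flips along a cut and every cut is realised by
-- switchings.  A cut telescopes, so it sums to zero on closed walks.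
-- Forward: flipping keeps adjacency, (uni/bi)colouredness and closed-walk
-- signs, and after switching f maps unicoloured edges to edges of the same
-- sign; this gives (i)-(iii).  Backward: by (iii) the sign discrepancy on
-- pairs that are unicoloured with unicoloured image is balanced, hence by
-- the potential theorem (proved by eliminating one vertex at a time) it is
-- a cut; switching along it, together with (i) and (ii), gives the
-- homomorphism.

open import Defs
open import Data.Nat using (ℕ; zero; suc)
open import Data.Fin using (Fin; zero; suc; _≟_)
open import Data.Fin.Properties using (any?)
open import Data.Bool using (Bool; true; false; _∧_; _∨_; not; if_then_else_; _xor_)
open import Data.Bool.Properties using (∨-comm; ∧-comm; ∨-zeroʳ; not-involutive; xor-assoc; xor-comm; xor-same; xor-identityʳ; xor-∧-commutativeRing) renaming (_≟_ to _≟ᴮ_)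
open import Algebra.Bundles using (CommutativeRing)
open import Algebra.Properties.CommutativeSemigroup (CommutativeRing.+-commutativeSemigroup xor-∧-commutativeRing) using (interchange)
open import Data.List using (List; []; _∷_; map)
open import Data.List.Relation.Unary.All using (All; []; _∷_)
import Data.List.Relation.Unary.All as All
open import Data.Product using (∃; _×_; _,_; proj₁; proj₂)
open import Data.Empty using (⊥-elim)
open import Function.Bundles using (_⇔_; mk⇔; Equivalence)
open import Relation.Nullary using (yes; no)
open import Relation.Nullary.Decidable using (⌊_⌋)
open import Relation.Binary.PropositionalEquality using (_≡_; refl; sym; trans; cong; cong₂; module ≡-Reasoning)
open import Relation.Binary.Construct.Closure.ReflexiveTransitive using (ε; _◅_)

∧-intro : ∀ {a b} → a ≡ true → b ≡ true → a ∧ b ≡ true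
∧-intro refl refl = refl

∧-elimˡ : ∀ {a b} → a ∧ b ≡ true → a ≡ true
∧-elimˡ {true} _ = refl

∧-elimʳ : ∀ {a b} → a ∧ b ≡ true → b ≡ true
∧-elimʳ {true} h = h

∨-preserved : ∀ {p q P Q} → (p ≡ true → P ≡ true) → (q ≡ true → Q ≡ true) → p ∨ q ≡ true → P ∨ Q ≡ true
∨-preserved {true}  {P = P} hp hq _ rewrite hp refl = refl
∨-preserved {false} {P = P} hp hq h rewrite hq h = ∨-zeroʳ P

∧-preserved : ∀ {p q P Q} → (p ≡ true → P ≡ true) → (q ≡ true → Q ≡ true) → p ∧ q ≡ true → P ∧ Q ≡ true
∧-preserved hp hq h = ∧-intro (hp (∧-elimˡ h)) (hq (∧-elimʳ h))

xor-cancelˡ : ∀ a b → a xor (a xor b) ≡ b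
xor-cancelˡ a b = trans (sym (xor-assoc a a b)) (cong (_xor b) (xor-same a))

xor≡false⇒≡ : ∀ a b → a xor b ≡ false → a ≡ b
xor≡false⇒≡ false b h = sym h
xor≡false⇒≡ true  b h = sym (trans (sym (not-involutive b)) (cong not h))

xor-rearrange : ∀ a b c e → a xor b ≡ c xor e → (a xor c) xor b ≡ e
xor-rearrange a b c e h = begin
  (a xor c) xor b   ≡⟨ xor-assoc a c b ⟩
  a xor (c xor b)   ≡⟨ cong (a xor_) (xor-comm c b) ⟩
  a xor (b xor c)   ≡⟨ sym (xor-assoc a b c) ⟩
  (a xor b) xor c   ≡⟨ cong (_xor c) h ⟩
  (c xor e) xor c   ≡⟨ xor-comm (c xor e) c ⟩
  c xor (c xor e)   ≡⟨ xor-cancelˡ c e ⟩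
  e                 ∎
  where open ≡-Reasoning

Labelling : ℕ → Set
Labelling n = Fin n → Fin n → Bool

Symmetric : ∀ {n} → Labelling n → Set
Symmetric d = ∀ u w → d u w ≡ d w u

cut : ∀ {n} → (Fin n → Bool) → Labelling n
cut s u w = s u xor s w

cut-sym : ∀ {n} (s : Fin n → Bool) → Symmetric (cut s)
cut-sym s u w = xor-comm (s u) (s w)

cut-xor : ∀ {n} (s s' : Fin n → Bool) u w → cut s u w xor cut s' u w ≡ cut (λ x → s x xor s' x) u w
cut-xor s s' u w = interchange (s u) (s w) (s' u) (s' w)

Along : ∀ {n} → (Fin n → Fin n → Set) → Fin n → List (Fin n) → Set
Along P x vs = All (λ e → P (proj₁ e) (proj₂ e)) (steps x vs)

Along-map : ∀ {n} {P Q : Fin n → Fin n → Set} → (∀ {a b} → P a b → Q a b) → ∀ {x vs} → Along P x vs → Along Q x vs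
Along-map h = All.map h

walkSum : ∀ {n} → Labelling n → Fin n → List (Fin n) → Bool
walkSum d x []       = false
walkSum d x (y ∷ ys) = d x y xor walkSum d y ys

walkSum-cong : ∀ {n} {d d' : Labelling n} x vs → Along (λ a b → d a b ≡ d' a b) x vs → walkSum d x vs ≡ walkSum d' x vs
walkSum-cong x []       []       = refl
walkSum-cong x (y ∷ ys) (e ∷ es) = cong₂ _xor_ e (walkSum-cong y ys es)

walkSum-xor : ∀ {n} (d d' : Labelling n) x vs → walkSum (λ a b → d a b xor d' a b) x vs ≡ walkSum d x vs xor walkSum d' x vs
walkSum-xor d d' x []       = refl
walkSum-xor d d' x (y ∷ ys) =
  trans (cong ((d x y xor d' x y) xor_) (walkSum-xor d d' y ys)) (interchange (d x y) (d' x y) _ _)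

walkSum-cut : ∀ {n} (s : Fin n → Bool) x vs → walkSum (cut s) x vs ≡ s x xor s (endpoint x vs)
walkSum-cut s x []       = sym (xor-same (s x))
walkSum-cut s x (y ∷ ys) = begin
  (s x xor s y) xor walkSum (cut s) y ys   ≡⟨ cong ((s x xor s y) xor_) (walkSum-cut s y ys) ⟩
  (s x xor s y) xor (s y xor s e)          ≡⟨ xor-assoc (s x) (s y) _ ⟩
  s x xor (s y xor (s y xor s e))          ≡⟨ cong (s x xor_) (xor-cancelˡ (s y) (s e)) ⟩
  s x xor s e                              ∎
  where
  e : Fin _
  e = endpoint y ys
  open ≡-Reasoning

walkSum-cut-closed : ∀ {n} (s : Fin n → Bool) x vs → endpoint x vs ≡ x → walkSum (cut s) x vs ≡ false
walkSum-cut-closed s x vs closed =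
  trans (walkSum-cut s x vs) (trans (cong (λ z → s x xor s z) closed) (xor-same (s x)))

pullback : ∀ {n m} → (Fin n → Fin m) → Labelling m → Labelling n
pullback f d a b = d (f a) (f b)

walkSum-image : ∀ {n m} (d : Labelling m) (f : Fin n → Fin m) x vs → walkSum d (f x) (map f vs) ≡ walkSum (pullback f d) x vs
walkSum-image d f x []       = refl
walkSum-image d f x (y ∷ ys) = cong (d (f x) (f y) xor_) (walkSum-image d f y ys)

Along-image : ∀ {n m} (P : Fin m → Fin m → Set) (f : Fin n → Fin m) x vs →
  Along P (f x) (map f vs) ⇔ Along (λ a b → P (f a) (f b)) x vs
Along-image P f x vs = mk⇔ (to x vs) (from x vs)
  where
  to : ∀ x vs → Along P (f x) (map f vs) → Along (λ a b → P (f a) (f b)) x vs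
  to x []       []       = []
  to x (y ∷ ys) (p ∷ ps) = p ∷ to y ys ps
  from : ∀ x vs → Along (λ a b → P (f a) (f b)) x vs → Along P (f x) (map f vs)
  from x []       []       = []
  from x (y ∷ ys) (p ∷ ps) = p ∷ from y ys ps

Balanced : ∀ {n} → Labelling n → Labelling n → Set
Balanced E d = ∀ x vs → endpoint x vs ≡ x → Along (λ a b → E a b ≡ true) x vs → walkSum d x vs ≡ false

Potential : ∀ {n} → Labelling n → Labelling n → (Fin n → Bool) → Set
Potential E d s = ∀ u w → E u w ≡ true → cut s u w ≡ d u w

loop-label : ∀ {n} {E d : Labelling n} → Balanced E d → ∀ z → E z z ≡ true → d z z ≡ false
loop-label {d = d} bal z ezz = trans (sym (xor-identityʳ (d z z))) (bal z (z ∷ []) refl (ezz ∷ []))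

triangle-label : ∀ {n} {E d : Labelling n} → Symmetric d → Balanced E d →
  ∀ a z b → E a z ≡ true → E z b ≡ true → E b a ≡ true → d a b ≡ d a z xor d z b
triangle-label {d = d} sd bal a z b eaz ezb eba = sym (xor≡false⇒≡ _ _ (begin
  (d a z xor d z b) xor d a b            ≡⟨ xor-assoc (d a z) (d z b) (d a b) ⟩
  d a z xor (d z b xor d a b)            ≡⟨ cong (λ t → d a z xor (d z b xor t)) (sym (trans (xor-identityʳ (d b a)) (sd b a))) ⟩
  walkSum d a (z ∷ b ∷ a ∷ [])           ≡⟨ bal a (z ∷ b ∷ a ∷ []) refl (eaz ∷ ezb ∷ eba ∷ []) ⟩
  false                                  ∎))
  where open ≡-Reasoning

-- Eliminating the vertex zero: two remaining vertices become adjacent when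
-- they are adjacent directly or through zero, labelled by the direct label
-- or the sum of the two labels through zero.  A potential of the smaller
-- graph extends to one of the original graph.
module Elimination {n : ℕ} {E d : Labelling (suc n)} (sE : Symmetric E) (sd : Symmetric d) (bal : Balanced E d) where

  E⁻ : Labelling n
  E⁻ u w = E (suc u) (suc w) ∨ (E (suc u) zero ∧ E zero (suc w))

  d⁻ : Labelling n
  d⁻ u w = if E (suc u) (suc w) then d (suc u) (suc w) else d (suc u) zero xor d zero (suc w)

  E⁻-sym : Symmetric E⁻
  E⁻-sym u w = cong₂ _∨_ (sE (suc u) (suc w))
    (trans (cong₂ _∧_ (sE (suc u) zero) (sE zero (suc w))) (∧-comm (E zero (suc u)) (E (suc w) zero)))

  d⁻-sym : Symmetric d⁻
  d⁻-sym u w rewrite sE (suc u) (suc w) | sd (suc u) (suc w) =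
    cong (if E (suc w) (suc u) then d (suc w) (suc u) else_)
      (trans (xor-comm (d (suc u) zero) (d zero (suc w))) (cong₂ _xor_ (sd zero (suc w)) (sd (suc u) zero)))

  -- A walk of the smaller graph lifts to one of E with the same sum,
  -- detouring through zero wherever the direct edge is missing.
  lift : Fin n → List (Fin n) → List (Fin (suc n))
  lift x []       = []
  lift x (y ∷ ys) = if E (suc x) (suc y) then suc y ∷ lift y ys else zero ∷ suc y ∷ lift y ys

  lift-endpoint : ∀ x vs → endpoint (suc x) (lift x vs) ≡ suc (endpoint x vs)
  lift-endpoint x []       = refl
  lift-endpoint x (y ∷ ys) with E (suc x) (suc y)
  ... | true  = lift-endpoint y ys
  ... | false = lift-endpoint y ys

  lift-along : ∀ x vs → Along (λ a b → E⁻ a b ≡ true) x vs → Along (λ a b → E a b ≡ true) (suc x) (lift x vs)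
  lift-along x []       []       = []
  lift-along x (y ∷ ys) (e ∷ es) with E (suc x) (suc y) in direct
  ... | true  = direct ∷ lift-along y ys es
  ... | false = ∧-elimˡ e ∷ ∧-elimʳ e ∷ lift-along y ys es

  lift-walkSum : ∀ x vs → walkSum d (suc x) (lift x vs) ≡ walkSum d⁻ x vs
  lift-walkSum x []       = refl
  lift-walkSum x (y ∷ ys) with E (suc x) (suc y)
  ... | true  = cong (d (suc x) (suc y) xor_) (lift-walkSum y ys)
  ... | false = trans (sym (xor-assoc (d (suc x) zero) (d zero (suc y)) _))
                      (cong ((d (suc x) zero xor d zero (suc y)) xor_) (lift-walkSum y ys))

  balanced⁻ : Balanced E⁻ d⁻
  balanced⁻ x vs closed along = trans (sym (lift-walkSum x vs))
    (bal (suc x) (lift x vs) (trans (lift-endpoint x vs) (cong suc closed)) (lift-along x vs along))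

  E⁻-direct : ∀ u w → E (suc u) (suc w) ≡ true → E⁻ u w ≡ true
  E⁻-direct u w e = cong (_∨ (E (suc u) zero ∧ E zero (suc w))) e

  d⁻-direct : ∀ u w → E (suc u) (suc w) ≡ true → d⁻ u w ≡ d (suc u) (suc w)
  d⁻-direct u w e rewrite e = refl

  E⁻-via-zero : ∀ u w → E (suc u) zero ≡ true → E zero (suc w) ≡ true → E⁻ u w ≡ true
  E⁻-via-zero u w eu ew rewrite eu | ew = ∨-zeroʳ (E (suc u) (suc w))

  -- Through a common neighbour zero the reduced label is the sum through
  -- zero, by definition or, if there is also a direct edge, by the triangle.
  d⁻-via-zero : ∀ u w → E (suc u) zero ≡ true → E zero (suc w) ≡ true → d⁻ u w ≡ d (suc u) zero xor d zero (suc w)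
  d⁻-via-zero u w eu ew with E (suc u) (suc w) in direct
  ... | true  = triangle-label sd bal (suc u) zero (suc w) eu ew (trans (sE (suc w) (suc u)) direct)
  ... | false = refl

  potential-of-parts : ∀ (s : Fin (suc n) → Bool) →
    (∀ w → E zero (suc w) ≡ true → cut s zero (suc w) ≡ d zero (suc w)) →
    Potential E⁻ d⁻ (λ v → s (suc v)) → Potential E d s
  potential-of-parts s at-zero pot⁻ zero    zero    e = trans (xor-same (s zero)) (sym (loop-label bal zero e))
  potential-of-parts s at-zero pot⁻ zero    (suc w) e = at-zero w e
  potential-of-parts s at-zero pot⁻ (suc v) zero    e =
    trans (xor-comm (s (suc v)) (s zero)) (trans (at-zero v (trans (sE zero (suc v)) e)) (sd zero (suc v)))
  potential-of-parts s at-zero pot⁻ (suc a) (suc b) e = trans (pot⁻ a b (E⁻-direct a b e)) (d⁻-direct a b e)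

  -- Extend by giving zero the value forced by one of its neighbours, if any.
  extend : ∃ (Potential E⁻ d⁻) → ∃ (Potential E d)
  extend (s' , pot⁻) with any? (λ u → E zero (suc u) ≟ᴮ true)
  ... | yes (u , ezu) = s , potential-of-parts s at-zero pot⁻
    where
    s : Fin (suc n) → Bool
    s zero    = s' u xor d zero (suc u)
    s (suc v) = s' v
    euz : E (suc u) zero ≡ true
    euz = trans (sE (suc u) zero) ezu
    at-zero : ∀ w → E zero (suc w) ≡ true → cut s zero (suc w) ≡ d zero (suc w)
    at-zero w ezw = xor-rearrange (s' u) (s' w) (d zero (suc u)) (d zero (suc w)) (begin
      s' u xor s' w                       ≡⟨ pot⁻ u w (E⁻-via-zero u w euz ezw) ⟩
      d⁻ u w                              ≡⟨ d⁻-via-zero u w euz ezw ⟩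
      d (suc u) zero xor d zero (suc w)   ≡⟨ cong (_xor d zero (suc w)) (sd (suc u) zero) ⟩
      d zero (suc u) xor d zero (suc w)   ∎)
      where open ≡-Reasoning
  ... | no isolated = s , potential-of-parts s (λ w ezw → ⊥-elim (isolated (w , ezw))) pot⁻
    where
    s : Fin (suc n) → Bool
    s zero    = false
    s (suc v) = s' v

potential : ∀ n (E d : Labelling n) → Symmetric E → Symmetric d → Balanced E d → ∃ (Potential E d)
potential zero    E d sE sd bal = (λ ()) , λ ()
potential (suc n) E d sE sd bal = extend (potential n E⁻ d⁻ E⁻-sym d⁻-sym balanced⁻)
  where open Elimination sE sd bal

isNegative : Sign → Bool
isNegative plus  = false
isNegative minus = true

isNegative-injective : ∀ a b → isNegative a ≡ isNegative b → a ≡ b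
isNegative-injective plus  plus  _ = refl
isNegative-injective minus minus _ = refl
isNegative-injective plus  minus ()
isNegative-injective minus plus  ()

isNegative-· : ∀ a b → isNegative (a · b) ≡ isNegative a xor isNegative b
isNegative-· plus  b     = refl
isNegative-· minus plus  = refl
isNegative-· minus minus = refl

signLabel : ∀ {n} → Signed n → Labelling n
signLabel G u w = not (pos G u w)

isNegative-edgeSign : ∀ {n} (G : Signed n) u w → isNegative (edgeSign G u w) ≡ signLabel G u w
isNegative-edgeSign G u w with pos G u w
... | true  = refl
... | false = refl

isNegative-walkSign : ∀ {n} (G : Signed n) x vs → isNegative (walkSign G x vs) ≡ walkSum (signLabel G) x vs
isNegative-walkSign G x []       = refl
isNegative-walkSign G x (y ∷ ys) = trans (isNegative-· (edgeSign G x y) (walkSign G y ys))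
  (cong₂ _xor_ (isNegative-edgeSign G x y) (isNegative-walkSign G y ys))

same-walkSign⇔ : ∀ {n m} (G : Signed n) (H : Signed m) (f : Fin n → Fin m) x vs →
  walkSign G x vs ≡ walkSign H (f x) (map f vs) ⇔ walkSum (signLabel G) x vs ≡ walkSum (pullback f (signLabel H)) x vs
same-walkSign⇔ G H f x vs = mk⇔
  (λ eq → trans (sym (isNegative-walkSign G x vs)) (trans (cong isNegative eq) image-sum))
  (λ eq → isNegative-injective _ _ (trans (isNegative-walkSign G x vs) (trans eq (sym image-sum))))
  where
  image-sum : isNegative (walkSign H (f x) (map f vs)) ≡ walkSum (pullback f (signLabel H)) x vs
  image-sum = trans (isNegative-walkSign H (f x) (map f vs)) (walkSum-image (signLabel H) f x vs)

record Flipped {n} (t : Labelling n) (G G' : Signed n) : Set where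
  constructor flipped
  field
    swapped : ∀ u w →
      (pos G' u w ≡ (if t u w then neg G u w else pos G u w)) ×
      (neg G' u w ≡ (if t u w then pos G u w else neg G u w))
open Flipped

Flipped-cong : ∀ {n} {t t' : Labelling n} {G G' : Signed n} → (∀ u w → t u w ≡ t' u w) → Flipped t G G' → Flipped t' G G'
Flipped-cong {G = G} eq fl = flipped λ u w →
  trans (proj₁ (swapped fl u w)) (cong (λ b → if b then neg G u w else pos G u w) (eq u w)) ,
  trans (proj₂ (swapped fl u w)) (cong (λ b → if b then pos G u w else neg G u w) (eq u w))

if-flip-flip : ∀ t t' (p q : Bool) → (if t' then (if t then p else q) else (if t then q else p)) ≡ (if t xor t' then q else p)
if-flip-flip false false p q = refl
if-flip-flip false true  p q = refl
if-flip-flip true  false p q = refl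
if-flip-flip true  true  p q = refl

Flipped-compose : ∀ {n} {t t' : Labelling n} {G G₁ G₂ : Signed n} →
  Flipped t G G₁ → Flipped t' G₁ G₂ → Flipped (λ u w → t u w xor t' u w) G G₂
Flipped-compose {t = t} {t'} {G} fl fl' = flipped λ u w →
  let (pos₁ , neg₁) = swapped fl u w
      (pos₂ , neg₂) = swapped fl' u w
  in trans pos₂ (trans (cong₂ (λ x y → if t' u w then x else y) neg₁ pos₁) (if-flip-flip (t u w) (t' u w) (pos G u w) (neg G u w))) ,
     trans neg₂ (trans (cong₂ (λ x y → if t' u w then x else y) pos₁ neg₁) (if-flip-flip (t u w) (t' u w) (neg G u w) (pos G u w)))

flipBy : ∀ {n} (t : Labelling n) → Symmetric t → Signed n → Signed n
flipBy t st G = record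
  { pos     = λ u w → if t u w then neg G u w else pos G u w
  ; neg     = λ u w → if t u w then pos G u w else neg G u w
  ; pos-sym = λ u w → if-cong (st u w) (neg-sym G u w) (pos-sym G u w)
  ; neg-sym = λ u w → if-cong (st u w) (pos-sym G u w) (neg-sym G u w)
  }
  where
  if-cong : ∀ {b b' x x' y y' : Bool} → b ≡ b' → x ≡ x' → y ≡ y' → (if b then x else y) ≡ (if b' then x' else y')
  if-cong refl refl refl = refl

flipBy-flipped : ∀ {n} (t : Labelling n) (st : Symmetric t) (G : Signed n) → Flipped t G (flipBy t st G)
flipBy-flipped t st G = flipped λ u w → refl , refl

at : ∀ {n} → Fin n → Fin n → Bool
at v x = ⌊ x ≟ v ⌋

at-suc : ∀ {n} (v x : Fin n) → at (suc v) (suc x) ≡ at v x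
at-suc v x with x ≟ v
... | yes _ = refl
... | no  _ = refl

-- Switching at v flips exactly the cut of {v}; loops are never flipped
-- since a cut vanishes on them.
flips-cut : ∀ {n} (v u w : Fin n) → flips v u w ≡ cut (at v) u w
flips-cut v u w with u ≟ w
... | yes refl = sym (xor-same (at v u))
... | no u≢w with u ≟ v | w ≟ v
...   | yes refl | yes refl = ⊥-elim (u≢w refl)
...   | yes _    | no  _    = refl
...   | no  _    | yes _    = refl
...   | no  _    | no  _    = refl

switching⇒cut : ∀ {n} {G G' : Signed n} → SwEq G G' → ∃ λ s → Flipped (cut s) G G'
switching⇒cut ε = (λ _ → false) , flipped λ u w → refl , refl
switching⇒cut ((v , step) ◅ rest) with switching⇒cut rest
... | s , fl = (λ x → at v x xor s x) ,
  Flipped-cong (λ u w → trans (cong (_xor cut s u w) (flips-cut v u w)) (cut-xor (at v) s u w))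
               (Flipped-compose (flipped step) fl)

parity : ∀ {n} → List (Fin n) → Fin n → Bool
parity []       x = false
parity (v ∷ vs) x = at v x xor parity vs x

parity-shift-zero : ∀ {n} (vs : List (Fin n)) → parity (map suc vs) zero ≡ false
parity-shift-zero []       = refl
parity-shift-zero (v ∷ vs) = parity-shift-zero vs

parity-shift-suc : ∀ {n} (vs : List (Fin n)) x → parity (map suc vs) (suc x) ≡ parity vs x
parity-shift-suc []       x = refl
parity-shift-suc (v ∷ vs) x = cong₂ _xor_ (at-suc v x) (parity-shift-suc vs x)

switchAll : ∀ {n} (G : Signed n) vs → ∃ λ G' → SwEq G G' × Flipped (cut (parity vs)) G G'
switchAll G []       = G , ε , flipped λ u w → refl , refl
switchAll G (v ∷ vs) with switchAll (flipBy (cut (at v)) (cut-sym (at v)) G) vs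
... | G' , switching , fl =
  G' , (v , swapped (Flipped-cong (λ u w → sym (flips-cut v u w)) first)) ◅ switching ,
  Flipped-cong (cut-xor (at v) (parity vs)) (Flipped-compose first fl)
  where
  first : Flipped (cut (at v)) G (flipBy (cut (at v)) (cut-sym (at v)) G)
  first = flipBy-flipped (cut (at v)) (cut-sym (at v)) G

support : ∀ {n} → (Fin n → Bool) → List (Fin n)
support {zero}  s = []
support {suc n} s = if s zero then zero ∷ shifted else shifted
  where
  shifted : List (Fin (suc n))
  shifted = map suc (support (λ v → s (suc v)))

parity-support : ∀ {n} (s : Fin n → Bool) x → parity (support s) x ≡ s x
parity-support {suc n} s zero with s zero
... | true  = cong not (parity-shift-zero (support (λ v → s (suc v))))
... | false = parity-shift-zero (support (λ v → s (suc v)))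
parity-support {suc n} s (suc x) with s zero
... | true  = trans (parity-shift-suc (support (λ v → s (suc v))) x) (parity-support (λ v → s (suc v)) x)
... | false = trans (parity-shift-suc (support (λ v → s (suc v))) x) (parity-support (λ v → s (suc v)) x)

cut⇒switching : ∀ {n} (G : Signed n) (s : Fin n → Bool) → ∃ λ G' → SwEq G G' × Flipped (cut s) G G'
cut⇒switching G s with switchAll G (support s)
... | G' , switching , fl =
  G' , switching , Flipped-cong (λ u w → cong₂ _xor_ (parity-support s u) (parity-support s w)) fl

unicoloured : Bool → Bool → Bool
unicoloured p q = (p ∧ not q) ∨ (q ∧ not p)

unicoloured-complement : ∀ p q → unicoloured p q ≡ true → q ≡ not p
unicoloured-complement true  false _ = refl
unicoloured-complement false true  _ = refl

-- Any property of a pair that does not distinguish the two colours survives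
-- flipping; this covers adjacency, bicolouredness and unicolouredness.
flip-invariant : ∀ {n} {t : Labelling n} {G G' : Signed n} (op : Bool → Bool → Bool) →
  (∀ p q → op q p ≡ op p q) → Flipped t G G' → ∀ u w → op (pos G' u w) (neg G' u w) ≡ op (pos G u w) (neg G u w)
flip-invariant {t = t} op swap fl u w with t u w | swapped fl u w
... | false | p , q = cong₂ op p q
... | true  | p , q = trans (cong₂ op p q) (swap _ _)

flip-unicoloured : ∀ {n} {t : Labelling n} {G G' : Signed n} → Flipped t G G' → ∀ u w → Unicol G u w → Unicol G' u w
flip-unicoloured fl u w = trans (flip-invariant unicoloured (λ p q → ∨-comm (q ∧ not p) (p ∧ not q)) fl u w)

flip-sign : ∀ {n} {t : Labelling n} {G G' : Signed n} → Flipped t G G' →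
  ∀ u w → Unicol G u w → signLabel G' u w ≡ signLabel G u w xor t u w
flip-sign {t = t} {G} fl u w uni with t u w | swapped fl u w
... | false | p , _ = trans (cong not p) (sym (xor-identityʳ _))
... | true  | p , _ = trans (cong not (trans p (unicoloured-complement (pos G u w) (neg G u w) uni)))
                            (xor-comm true (not (pos G u w)))

flip-walkSum : ∀ {n} {s : Fin n → Bool} {G G' : Signed n} → Flipped (cut s) G G' →
  ∀ x vs → endpoint x vs ≡ x → UniWalk G x vs → walkSum (signLabel G') x vs ≡ walkSum (signLabel G) x vs
flip-walkSum {s = s} {G} {G'} fl x vs closed uni = begin
  walkSum (signLabel G') x vs                              ≡⟨ walkSum-cong x vs (Along-map (λ {a} {b} → flip-sign fl a b) uni) ⟩
  walkSum (λ a b → signLabel G a b xor cut s a b) x vs     ≡⟨ walkSum-xor (signLabel G) (cut s) x vs ⟩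
  walkSum (signLabel G) x vs xor walkSum (cut s) x vs      ≡⟨ cong (walkSum (signLabel G) x vs xor_) (walkSum-cut-closed s x vs closed) ⟩
  walkSum (signLabel G) x vs xor false                     ≡⟨ xor-identityʳ _ ⟩
  walkSum (signLabel G) x vs                               ∎
  where open ≡-Reasoning

same-sign : ∀ p q P Q → (p ≡ true → P ≡ true) → (q ≡ true → Q ≡ true) →
  unicoloured p q ≡ true → unicoloured P Q ≡ true → not p ≡ not P
same-sign true  _    true  _     _  _  _ _ = refl
same-sign true  _    false _     hp _  _ _ with hp refl
... | ()
same-sign false true false _     _  _  _ _ = refl
same-sign false true true  true  _  _  _ ()
same-sign false true true  false _  hq _ _ with hq refl
... | ()
same-sign false false _    _     _  _  () _

transfer : ∀ p q P Q t → (p ∨ q ≡ true → P ∨ Q ≡ true) → (p ∧ q ≡ true → P ∧ Q ≡ true) →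
  (unicoloured p q ≡ true → unicoloured P Q ≡ true → t ≡ not p xor not P) →
  ((if t then q else p) ≡ true → P ≡ true) × ((if t then p else q) ≡ true → Q ≡ true)
transfer p     q     true  true  t     _   _   _   = (λ _ → refl) , (λ _ → refl)
transfer false false P     Q     false _   _   _   = (λ ()) , (λ ())
transfer false false P     Q     true  _   _   _   = (λ ()) , (λ ())
transfer true  true  false Q     t     _   and _   with and refl
... | ()
transfer true  true  true  false t     _   and _   with and refl
... | ()
transfer true  false false false t     or  _   _   with or refl
... | ()
transfer false true  false false t     or  _   _   with or refl
... | ()
transfer true  false true  false t     _   _   uni with uni refl refl
... | refl = (λ _ → refl) , (λ ())
transfer true  false false true  t     _   _   uni with uni refl refl
... | refl = (λ ()) , (λ _ → refl)
transfer false true  true  false t     _   _   uni with uni refl refl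
... | refl = (λ _ → refl) , (λ ())
transfer false true  false true  t     _   _   uni with uni refl refl
... | refl = (λ ()) , (λ _ → refl)

flip-homomorphism : ∀ {n m} {t : Labelling n} {G G' : Signed n} (H : Signed m) (f : Fin n → Fin m) →
  Flipped t G G' → CondI G H f → CondII G H f →
  (∀ a b → Unicol G a b → Unicol H (f a) (f b) → t a b ≡ signLabel G a b xor signLabel H (f a) (f b)) →
  (∀ a b → pos G' a b ≡ true → pos H (f a) (f b) ≡ true) × (∀ a b → neg G' a b ≡ true → neg H (f a) (f b) ≡ true)
flip-homomorphism {t = t} H f fl adjacency bicoloured aligned =
  (λ a b h → proj₁ (transfer _ _ _ _ (t a b) (adjacency a b) (bicoloured a b) (aligned a b))
                    (trans (sym (proj₁ (swapped fl a b))) h)) ,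
  (λ a b h → proj₂ (transfer _ _ _ _ (t a b) (adjacency a b) (bicoloured a b) (aligned a b))
                    (trans (sym (proj₂ (swapped fl a b))) h))


forward : ∀ {n m} (G : Signed n) (H : Signed m) (f : Fin n → Fin m) → IsHom G H f → CondI G H f × CondII G H f × CondIII G H f
forward {n} G H f (G' , switching , hom⁺ , hom⁻) = adjacency , bicoloured , closed-walks
  where
  s : Fin n → Bool
  s = proj₁ (switching⇒cut switching)

  fl : Flipped (cut s) G G'
  fl = proj₂ (switching⇒cut switching)

  adjacency : CondI G H f
  adjacency u v a = ∨-preserved (hom⁺ u v) (hom⁻ u v) (trans (flip-invariant _∨_ (λ p q → ∨-comm q p) fl u v) a)

  bicoloured : CondII G H f
  bicoloured u v b = ∧-preserved (hom⁺ u v) (hom⁻ u v) (trans (flip-invariant _∧_ (λ p q → ∧-comm q p) fl u v) b)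

  aligned : ∀ x vs → UniWalk G x vs → Along (λ a b → Unicol H (f a) (f b)) x vs →
    Along (λ a b → signLabel G' a b ≡ pullback f (signLabel H) a b) x vs
  aligned x vs uniG uniH = All.zipWith
    (λ { {a , b} (uniG' , uniH') → same-sign _ _ _ _ (hom⁺ a b) (hom⁻ a b) uniG' uniH' })
    (Along-map (λ {a} {b} → flip-unicoloured fl a b) uniG , uniH)

  closed-walks : CondIII G H f
  closed-walks x vs closed uniG uniH = Equivalence.from (same-walkSign⇔ G H f x vs) (begin
    walkSum (signLabel G) x vs                 ≡⟨ sym (flip-walkSum {s = s} fl x vs closed uniG) ⟩
    walkSum (signLabel G') x vs                ≡⟨ walkSum-cong x vs (aligned x vs uniG uniH′) ⟩
    walkSum (pullback f (signLabel H)) x vs    ∎)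
    where
    open ≡-Reasoning
    uniH′ : Along (λ a b → Unicol H (f a) (f b)) x vs
    uniH′ = Equivalence.to (Along-image (Unicol H) f x vs) uniH

backward : ∀ {n m} (G : Signed n) (H : Signed m) (f : Fin n → Fin m) → CondI G H f × CondII G H f × CondIII G H f → IsHom G H f
backward {n} G H f (adjacency , bicoloured , closed-walks) =
  G' , switching , flip-homomorphism H f fl adjacency bicoloured aligned
  where
  E : Labelling n
  E a b = unicoloured (pos G a b) (neg G a b) ∧ unicoloured (pos H (f a) (f b)) (neg H (f a) (f b))

  d : Labelling n
  d a b = signLabel G a b xor pullback f (signLabel H) a b

  E-sym : Symmetric E
  E-sym a b = cong₂ _∧_ (cong₂ unicoloured (pos-sym G a b) (neg-sym G a b))
                        (cong₂ unicoloured (pos-sym H (f a) (f b)) (neg-sym H (f a) (f b)))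

  d-sym : Symmetric d
  d-sym a b = cong₂ _xor_ (cong not (pos-sym G a b)) (cong not (pos-sym H (f a) (f b)))

  balanced : Balanced E d
  balanced x vs closed along = begin
    walkSum d x vs                   ≡⟨ walkSum-xor (signLabel G) image x vs ⟩
    walkSum (signLabel G) x vs xor walkSum image x vs ≡⟨ cong (_xor walkSum image x vs) same-sum ⟩
    walkSum image x vs xor walkSum image x vs         ≡⟨ xor-same (walkSum image x vs) ⟩
    false                            ∎
    where
    open ≡-Reasoning
    image : Labelling n
    image = pullback f (signLabel H)
    same-sum : walkSum (signLabel G) x vs ≡ walkSum image x vs
    same-sum = Equivalence.to (same-walkSign⇔ G H f x vs) (closed-walks x vs closed (Along-map ∧-elimˡ along)
      (Equivalence.from (Along-image (Unicol H) f x vs) (Along-map ∧-elimʳ along)))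

  pot : ∃ (Potential E d)
  pot = potential n E d E-sym d-sym balanced

  aligned : ∀ a b → Unicol G a b → Unicol H (f a) (f b) → cut (proj₁ pot) a b ≡ d a b
  aligned a b uniG uniH = proj₂ pot a b (∧-intro uniG uniH)

  realised : ∃ λ G' → SwEq G G' × Flipped (cut (proj₁ pot)) G G'
  realised = cut⇒switching G (proj₁ pot)

  G' : Signed n
  G' = proj₁ realised

  switching : SwEq G G'
  switching = proj₁ (proj₂ realised)

  fl : Flipped (cut (proj₁ pot)) G G'
  fl = proj₂ (proj₂ realised)

lemma1 : ∀ {n m} (G : Signed n) (H : Signed m) (f : Fin n → Fin m) →
    IsHom G H f ⇔ (CondI G H f × CondII G H f × CondIII G H f)
lemma1 G H f = mk⇔ (forward G H f) (backward G H f)
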